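{- Let $G$ be a finite simple outerplanar graph with maximum degree $\Delta = k \in \{3,4\}$. Then $\mathrm{ind}(G^2) \leq 2k-2$.
   Context: $G^2$ is the graph on $V(G)$ in which two distinct vertices are adjacent iff their distance in $G$ is 1 or 2. The inductiveness of a graph $H$ is $\mathrm{ind}(H) = \max\{\delta(H') : H' \text{ an induced subgraph of } H\}$, $\delta$ denoting minimum degree. -}

module Defs where

open import Data.Nat using (ℕ; zero; suc; _+_)
open import Data.Bool using (Bool; true; false; _∧_; _∨_; not; T; if_then_else_)
open import Data.Fin using (Fin; _<_; _≟_)
open import Data.Product using (Σ; _×_; ∃)
open import Relation.Nullary using (¬_; does)
open import Relation.Binary.PropositionalEquality using (_≡_)
open import Function.Definitions using (Injective)

count : ∀ {n} → (Fin n → Bool) → ℕ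
count {zero}  p = 0
count {suc n} p = (if p Data.Fin.zero then 1 else 0) + count (λ i → p (Data.Fin.suc i))

anyFin : ∀ {n} → (Fin n → Bool) → Bool
anyFin {zero}  p = false
anyFin {suc n} p = p Data.Fin.zero ∨ anyFin (λ i → p (Data.Fin.suc i))

record SimpleGraph (n : ℕ) : Set where
  field
    adj   : Fin n → Fin n → Bool
    sym   : ∀ u v → adj u v ≡ adj v u
    irref : ∀ v → adj v v ≡ false
open SimpleGraph public

degree : ∀ {n} → SimpleGraph n → Fin n → ℕ
degree G v = count (adj G v)

MaxDegree : ∀ {n} → SimpleGraph n → ℕ → Set
MaxDegree G k = (∀ v → degree G v Data.Nat.≤ k) × ∃ (λ v → degree G v ≡ k)

-- outerplanar: vertices can be placed in (injective) cyclic order on a circle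
-- so that edges, drawn as chords, do not cross (no interleaving endpoints)
Outerplanar : ∀ {n} → SimpleGraph n → Set
Outerplanar {n} G =
  Σ (Fin n → Fin n) λ pos → Injective _≡_ _≡_ pos ×
    (∀ a b c d → T (adj G a b) → T (adj G c d) →
       ¬ (pos a < pos c × pos c < pos b × pos b < pos d))

sqAdj : ∀ {n} → SimpleGraph n → Fin n → Fin n → Bool
sqAdj G u v = not (does (u ≟ v)) ∧ (adj G u v ∨ anyFin (λ w → adj G u w ∧ adj G w v))

inducedSqDegree : ∀ {n} → SimpleGraph n → (Fin n → Bool) → Fin n → ℕ
inducedSqDegree G S v = count (λ u → S u ∧ sqAdj G v u)

-- ind(G²) ≤ m : every nonempty induced subgraph of G² has minimum degree ≤ m
IndSqAtMost : ∀ {n} → SimpleGraph n → ℕ → Set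
IndSqAtMost G m = ∀ S → ∃ (λ v → T (S v)) →
  ∃ (λ v → T (S v) × inducedSqDegree G S v Data.Nat.≤ m)

-- Number the vertices along the circle of the outerplanar drawing and call an edge occupied when a
-- vertex of S lies strictly between its ends. If no edge is occupied, any s ∈ S will do: the only
-- S-vertex strictly between s and a G²-neighbour u is the middle vertex of an s–u path, so s has at
-- most two G²-neighbours in S on each side. Otherwise take an occupied edge pq of minimal span. As
-- chords do not cross, neighbours of vertices strictly inside pq stay in [p, q], and by minimality no
-- edge at an inside vertex is occupied. If some inside S-vertex has inside S-vertices on both sides,
-- its neighbours are inside as well and the count above gives 4 ≤ 2k − 2. Otherwise at most two
-- S-vertices lie inside, and an inside S-vertex s₁ reaches in G² only p, q, the other inside
-- S-vertex and neighbours of p or q, at most 2k − 2 vertices in all: if s₁ is adjacent to both p and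
-- q, the other inside vertex would make s₁p or s₁q occupied.

module Submission where

open import Defs renaming (sym to adj-sym)
open import Data.Bool using (Bool; true; false; _∧_; _∨_; not; T; if_then_else_)
open import Data.Bool.Properties using (T-∧; T-∨; T-≡; T?)
open import Data.Empty using (⊥; ⊥-elim)
open import Data.List using (List; []; _∷_; map; filter; allFin; cartesianProduct)
open import Data.List.Extrema.Nat using (argmin; argmin-all; f[argmin]≤f[xs])
open import Data.List.Membership.Propositional using (_∈_)
open import Data.List.Membership.Propositional.Properties
  using (∈-filter⁺; ∈-allFin; ∈-cartesianProduct⁺)
import Data.List.Relation.Unary.All as All
open import Data.List.Relation.Unary.All.Properties using (all-filter)
open import Data.List.Relation.Unary.Any using (Any; here; there)
open import Data.List.Relation.Unary.Any.Properties using (¬Any[])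
open import Data.Nat.ListAction using (sum)
open import Data.Fin using (Fin; zero; suc; toℕ; _≟_)
import Data.Fin.Properties as Fin
open import Data.Nat using (ℕ; zero; suc; _+_; _*_; _∸_; _≤_; _<_; z≤n; s≤s)
open import Data.Nat.Properties
  using (≤-refl; ≤-reflexive; ≤-pred; ≤-trans; ≤-<-trans; <-≤-trans; ≤-antisym; <⇒≤; <⇒≱; ≮⇒≥;
         +-identityʳ; +-mono-≤; +-suc; +-commutativeSemigroup;
         ∸-monoˡ-≤; ∸-monoʳ-≤; ∸-monoˡ-<; ∸-monoʳ-<)
open import Data.Product using (_×_; _,_; proj₁; proj₂; ∃)
open import Data.Sum using (_⊎_; inj₁; inj₂)
open import Data.Unit using (tt)
open import Function using (_∘_)
open import Function.Bundles using (Equivalence)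
open import Relation.Nullary using (¬_; Dec; yes; no; does)
open import Relation.Nullary.Decidable using (_×-dec_)
open import Relation.Binary.Definitions using (Trichotomous; Decidable; tri<; tri≈; tri>)
open import Function.Definitions using (Injective)
open import Relation.Binary.PropositionalEquality
  using (_≡_; refl; sym; trans; cong; subst; module ≡-Reasoning)
open import Algebra.Properties.CommutativeSemigroup +-commutativeSemigroup using (interchange)

open Equivalence using (to; from)

private
  indicator-mono : ∀ {b c} → (T b → T c) → (if b then 1 else 0) ≤ (if c then 1 else 0)
  indicator-mono {false}         _   = z≤n
  indicator-mono {true} {true}   _   = ≤-refl
  indicator-mono {true} {false} b⇒c = ⊥-elim (b⇒c tt)

  indicator-∨ : ∀ b c → (if b ∨ c then 1 else 0) ≤ (if b then 1 else 0) + (if c then 1 else 0)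
  indicator-∨ false c = ≤-refl
  indicator-∨ true  c = s≤s z≤n

  ≡true⇒T : ∀ {b} → b ≡ true → T b
  ≡true⇒T = from T-≡

T-∧⁻ : ∀ x {y} → T (x ∧ y) → T x × T y
T-∧⁻ true t = tt , t

T-not⇒¬T : ∀ b → T (not b) → ¬ T b
T-not⇒¬T false _ ()

does⇒ : ∀ {P : Set} (d : Dec P) → T (does d) → P
does⇒ (yes p) _ = p

⇒does : ∀ {P : Set} (d : Dec P) → P → T (does d)
⇒does (yes _)  _ = tt
⇒does (no ¬p)  p = ¬p p

⇒¬does : ∀ {P : Set} (d : Dec P) → ¬ P → T (not (does d))
⇒¬does (yes p) ¬p = ¬p p
⇒¬does (no _)  _  = tt

¬does⇒ : ∀ {P : Set} (d : Dec P) → T (not (does d)) → ¬ P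
¬does⇒ (no ¬p) _ = ¬p

count-mono : ∀ {n} {f g : Fin n → Bool} → (∀ i → T (f i) → T (g i)) → count f ≤ count g
count-mono {zero}  f⊆g = z≤n
count-mono {suc n} f⊆g = +-mono-≤ (indicator-mono (f⊆g zero)) (count-mono (f⊆g ∘ suc))

count-∨ : ∀ {n} (f g : Fin n → Bool) → count (λ i → f i ∨ g i) ≤ count f + count g
count-∨ {zero}  f g = z≤n
count-∨ {suc n} f g = ≤-trans
  (+-mono-≤ (indicator-∨ (f zero) (g zero)) (count-∨ (f ∘ suc) (g ∘ suc)))
  (≤-reflexive (interchange (if f zero then 1 else 0) _ _ _))

count-split : ∀ {n} {f : Fin n → Bool} (g h : Fin n → Bool) →
  (∀ i → T (f i) → T (g i) ⊎ T (h i)) → count f ≤ count g + count h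
count-split g h cover = ≤-trans (count-mono λ i fi → from (T-∨ {g i} {h i}) (cover i fi)) (count-∨ g h)

count-none : ∀ {n} {f : Fin n → Bool} → (∀ i → ¬ T (f i)) → count f ≡ 0
count-none {zero}              _     = refl
count-none {suc n} {f} none with f zero in f₀
... | true  = ⊥-elim (none zero (≡true⇒T f₀))
... | false = count-none (none ∘ suc)

count-≤1 : ∀ {n} {f : Fin n → Bool} → (∀ i j → T (f i) → T (f j) → i ≡ j) → count f ≤ 1
count-≤1 {zero}              _      = z≤n
count-≤1 {suc n} {f} unique with f zero in f₀
... | true  = s≤s (≤-reflexive (count-none λ i fi → 0≢suc (unique zero (suc i) (≡true⇒T f₀) fi)))
  where
  0≢suc : ∀ {i : Fin n} → ¬ zero ≡ suc i
  0≢suc ()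
... | false = count-≤1 λ i j fi fj → Fin.suc-injective (unique (suc i) (suc j) fi fj)

count-≤2 : ∀ {n} {f : Fin n → Bool} →
  (∀ i j l → T (f i) → T (f j) → T (f l) → i ≡ j ⊎ i ≡ l ⊎ j ≡ l) → count f ≤ 2
count-≤2 {zero}            _       = z≤n
count-≤2 {suc n} {f} repeat with f zero in f₀
... | true  = s≤s (count-≤1 λ i j fi fj → tailRepeat (repeat zero (suc i) (suc j) (≡true⇒T f₀) fi fj))
  where
  tailRepeat : ∀ {i j : Fin n} → zero ≡ suc i ⊎ zero ≡ suc j ⊎ suc i ≡ suc j → i ≡ j
  tailRepeat (inj₂ (inj₂ e)) = Fin.suc-injective e
... | false = count-≤2 λ i j l fi fj fl → tailRepeat (repeat (suc i) (suc j) (suc l) fi fj fl)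
  where
  tailRepeat : ∀ {i j l : Fin n} → suc i ≡ suc j ⊎ suc i ≡ suc l ⊎ suc j ≡ suc l → i ≡ j ⊎ i ≡ l ⊎ j ≡ l
  tailRepeat (inj₁ e)        = inj₁ (Fin.suc-injective e)
  tailRepeat (inj₂ (inj₁ e)) = inj₂ (inj₁ (Fin.suc-injective e))
  tailRepeat (inj₂ (inj₂ e)) = inj₂ (inj₂ (Fin.suc-injective e))

count-cover : ∀ {n} {f : Fin n → Bool} (gs : List (Fin n → Bool)) →
  (∀ i → T (f i) → Any (λ g → T (g i)) gs) → count f ≤ sum (map count gs)
count-cover []       cover = ≤-reflexive (count-none λ i fi → ¬Any[] (cover i fi))
count-cover {f = f} (g ∷ gs) cover =
  ≤-trans (count-split g rest peel) (+-mono-≤ ≤-refl (count-cover gs rest-cover))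
  where
  rest : _ → Bool
  rest i = f i ∧ not (g i)
  peel : ∀ i → T (f i) → T (g i) ⊎ T (rest i)
  peel i fi with g i
  ... | true  = inj₁ tt
  ... | false = inj₂ (from T-∧ (fi , tt))
  rest-cover : ∀ i → T (rest i) → Any (λ g → T (g i)) gs
  rest-cover i ri with T-∧⁻ (f i) ri
  ... | fi , ¬gi with cover i fi
  ...   | here gi    = ⊥-elim (T-not⇒¬T (g i) ¬gi gi)
  ...   | there rest = rest

count-≟≤1 : ∀ {n} (a : Fin n) → count (λ i → does (i ≟ a)) ≤ 1
count-≟≤1 a = count-≤1 λ i j i≡a j≡a → trans (does⇒ (i ≟ a) i≡a) (sym (does⇒ (j ≟ a) j≡a))

anyFin⇒∃ : ∀ {n} {p : Fin n → Bool} → T (anyFin p) → ∃ λ i → T (p i)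
anyFin⇒∃ {suc n} t with to T-∨ t
... | inj₁ p₀   = zero , p₀
... | inj₂ rest with anyFin⇒∃ rest
...   | i , pᵢ  = suc i , pᵢ

count-remove : ∀ {n} (f : Fin n → Bool) {a} → T (f a) →
  suc (count (λ i → f i ∧ not (does (i ≟ a)))) ≤ count f
count-remove f {zero} fa with f zero
... | true = s≤s (count-mono {f = λ i → f (suc i) ∧ true} λ i fi → proj₁ (to T-∧ fi))
count-remove f {suc a} fa =
  ≤-trans (≤-reflexive (sym (+-suc (if f zero ∧ true then 1 else 0) _)))
          (+-mono-≤ (indicator-mono (proj₁ ∘ to T-∧)) (count-remove (f ∘ suc) fa))

∃-argmin : ∀ {A : Set} {P : A → Set} → (∀ x → Dec (P x)) → (f : A → ℕ) (xs : List A) → (∀ x → x ∈ xs) →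
  ∀ {x} → P x → ∃ λ m → P m × ∀ y → P y → f m ≤ f y
∃-argmin P? f xs complete {x} px =
  argmin f x (filter P? xs) ,
  argmin-all f px (all-filter P? xs) ,
  λ y py → All.lookup (f[argmin]≤f[xs] x (filter P? xs)) (∈-filter⁺ P? (complete y) py)

2+[k∸2]+[k∸2]≡2*k∸2 : ∀ {k} → 2 ≤ k → 2 + ((k ∸ 2) + (k ∸ 2)) ≡ 2 * k ∸ 2
2+[k∸2]+[k∸2]≡2*k∸2 {suc (suc j)} (s≤s (s≤s z≤n)) = sym (begin
  j + suc (suc (j + 0)) ≡⟨ +-suc j (suc (j + 0)) ⟩
  suc (j + suc (j + 0)) ≡⟨ cong suc (+-suc j (j + 0)) ⟩
  suc (suc (j + (j + 0))) ≡⟨ cong (λ m → suc (suc (j + m))) (+-identityʳ j) ⟩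
  suc (suc (j + j)) ∎)
  where open ≡-Reasoning

4≤2*k∸2 : ∀ {k} → 3 ≤ k → 4 ≤ 2 * k ∸ 2
4≤2*k∸2 3≤k =
  ≤-trans (s≤s (s≤s (+-mono-≤ 1≤k∸2 1≤k∸2))) (≤-reflexive (2+[k∸2]+[k∸2]≡2*k∸2 (<⇒≤ 3≤k)))
  where
  1≤k∸2 = ∸-monoˡ-≤ 2 3≤k

o+[v+w]≤m+m : ∀ {m o v w} → 1 ≤ m → o ≤ 1 → v ≤ m → w ≤ m → o ≡ 0 ⊎ v ≡ 0 ⊎ w ≡ 0 →
  o + (v + (w + 0)) ≤ m + m
o+[v+w]≤m+m {w = w} _   _   v≤m w≤m (inj₁ refl)        =
  +-mono-≤ v≤m (≤-trans (≤-reflexive (+-identityʳ w)) w≤m)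
o+[v+w]≤m+m {w = w} 1≤m o≤1 _   w≤m (inj₂ (inj₁ refl)) =
  +-mono-≤ (≤-trans o≤1 1≤m) (≤-trans (≤-reflexive (+-identityʳ w)) w≤m)
o+[v+w]≤m+m {v = v} 1≤m o≤1 v≤m _   (inj₂ (inj₂ refl)) =
  +-mono-≤ (≤-trans o≤1 1≤m) (≤-trans (≤-reflexive (+-identityʳ v)) v≤m)

nested-span : ∀ {p a b q} → p ≤ a → a ≤ b → b ≤ q → q ∸ p ≤ b ∸ a → a ≡ p × b ≡ q
nested-span {p} {a} {b} {q} p≤a a≤b b≤q wide =
  ≤-antisym (≮⇒≥ left-narrower) p≤a , ≤-antisym b≤q (≮⇒≥ right-narrower)
  where
  left-narrower : ¬ p < a
  left-narrower p<a = <⇒≱ (≤-<-trans (∸-monoˡ-≤ a b≤q) (∸-monoʳ-< p<a (≤-trans a≤b b≤q))) wide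
  right-narrower : ¬ b < q
  right-narrower b<q = <⇒≱ (<-≤-trans (∸-monoˡ-< b<q a≤b) (∸-monoʳ-≤ q p≤a)) wide

module Layout {n : ℕ} (pos : Fin n → Fin n) (pos-injective : Injective _≡_ _≡_ pos) where

  infix 4 _≺_ _≺?_

  rank : Fin n → ℕ
  rank a = toℕ (pos a)

  _≺_ : Fin n → Fin n → Set
  a ≺ b = rank a < rank b

  _≺?_ : Decidable _≺_
  a ≺? b = pos a Fin.<? pos b

  ≺-trans : ∀ {a b c} → a ≺ b → b ≺ c → a ≺ c
  ≺-trans = Fin.<-trans

  ≺-irrefl : ∀ {a b} → a ≡ b → ¬ a ≺ b
  ≺-irrefl refl = Fin.<-irrefl refl

  ≺-asym : ∀ {a b} → a ≺ b → ¬ b ≺ a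
  ≺-asym = Fin.<-asym

  rank-injective : ∀ {a b} → rank a ≡ rank b → a ≡ b
  rank-injective = pos-injective ∘ Fin.toℕ-injective

  span : Fin n → Fin n → ℕ
  span a b = rank b ∸ rank a

  ≺-cmp : Trichotomous _≡_ _≺_
  ≺-cmp a b with Fin.<-cmp (pos a) (pos b)
  ... | tri< a≺b a≢b b⊀a = tri< a≺b (a≢b ∘ cong pos) b⊀a
  ... | tri≈ a⊀b a≡b b⊀a = tri≈ a⊀b (pos-injective a≡b) b⊀a
  ... | tri> a⊀b a≢b b≺a = tri> a⊀b (a≢b ∘ cong pos) b≺a

  no-3-chain⇒count≤2 : {f : Fin n → Bool} →
    (∀ a b c → T (f a) → T (f b) → T (f c) → a ≺ b → b ≺ c → ⊥) → count f ≤ 2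
  no-3-chain⇒count≤2 {f} noChain = count-≤2 repeat
    where
    repeat : ∀ i j l → T (f i) → T (f j) → T (f l) → i ≡ j ⊎ i ≡ l ⊎ j ≡ l
    repeat i j l fi fj fl with ≺-cmp i j | ≺-cmp j l | ≺-cmp i l
    ... | tri≈ _ i≡j _ | _              | _              = inj₁ i≡j
    ... | _            | tri≈ _ j≡l _   | _              = inj₂ (inj₂ j≡l)
    ... | _            | _              | tri≈ _ i≡l _   = inj₂ (inj₁ i≡l)
    ... | tri< i≺j _ _ | tri< j≺l _ _   | _              = ⊥-elim (noChain i j l fi fj fl i≺j j≺l)
    ... | tri< i≺j _ _ | tri> _ _ l≺j   | tri< i≺l _ _   = ⊥-elim (noChain i l j fi fl fj i≺l l≺j)
    ... | tri< i≺j _ _ | tri> _ _ l≺j   | tri> _ _ l≺i   = ⊥-elim (noChain l i j fl fi fj l≺i i≺j)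
    ... | tri> _ _ j≺i | tri< j≺l _ _   | tri< i≺l _ _   = ⊥-elim (noChain j i l fj fi fl j≺i i≺l)
    ... | tri> _ _ j≺i | tri< j≺l _ _   | tri> _ _ l≺i   = ⊥-elim (noChain j l i fj fl fi j≺l l≺i)
    ... | tri> _ _ j≺i | tri> _ _ l≺j   | _              = ⊥-elim (noChain l j i fl fj fi l≺j j≺i)

  Between : Fin n → Fin n → Fin n → Set
  Between a w b = (a ≺ w × w ≺ b) ⊎ (b ≺ w × w ≺ a)

  Occupied : (Fin n → Bool) → Fin n → Fin n → Set
  Occupied S a b = ∃ λ w → T (S w) × a ≺ w × w ≺ b

  Occupied? : ∀ S a b → Dec (Occupied S a b)
  Occupied? S a b = Fin.any? λ w → T? (S w) ×-dec a ≺? w ×-dec w ≺? b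

  Clear : (Fin n → Bool) → Fin n → Fin n → Set
  Clear S a b = ∀ w → T (S w) → ¬ Between a w b

  Clear-join : ∀ {S a b c w} → Clear S a b → Clear S b c → T (S w) → Between a w c → w ≡ b
  Clear-join {b = b} {w = w} clear-ab clear-bc sw a-w-c with ≺-cmp w b | a-w-c
  ... | tri≈ _ w≡b _ | _                 = w≡b
  ... | tri< w≺b _ _ | inj₁ (a≺w , _)    = ⊥-elim (clear-ab w sw (inj₁ (a≺w , w≺b)))
  ... | tri< w≺b _ _ | inj₂ (c≺w , _)    = ⊥-elim (clear-bc w sw (inj₂ (c≺w , w≺b)))
  ... | tri> _ _ b≺w | inj₁ (_ , w≺c)    = ⊥-elim (clear-bc w sw (inj₁ (b≺w , w≺c)))
  ... | tri> _ _ b≺w | inj₂ (_ , w≺a)    = ⊥-elim (clear-ab w sw (inj₂ (b≺w , w≺a)))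

module Drawing {n : ℕ} (G : SimpleGraph n) (pos : Fin n → Fin n) (pos-injective : Injective _≡_ _≡_ pos)
  where

  open Layout pos pos-injective public

  E : Fin n → Fin n → Set
  E a b = T (adj G a b)

  E-sym : ∀ {a b} → E a b → E b a
  E-sym {a} {b} = subst T (adj-sym G a b)

  sqAdj⇒walk : ∀ {s u} → T (sqAdj G s u) → ¬ s ≡ u × (E s u ⊎ ∃ λ x → E s x × E x u)
  sqAdj⇒walk {s} {u} t with T-∧⁻ (not (does (s ≟ u))) t
  ... | s≢u , near with to T-∨ near
  ...   | inj₁ edge = ¬does⇒ (s ≟ u) s≢u , inj₁ edge
  ...   | inj₂ path with anyFin⇒∃ path
  ...     | x , sxu = ¬does⇒ (s ≟ u) s≢u , inj₂ (x , T-∧⁻ (adj G s x) sxu)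

  sqDegree≤4 : (S : Fin n → Bool) (s : Fin n) →
    (∀ {x} → E s x → Clear S s x) → (∀ {x y} → E s x → E x y → Clear S x y) →
    count (λ u → S u ∧ sqAdj G s u) ≤ 4
  sqDegree≤4 S s clear₁ clear₂ =
    ≤-trans (count-split right left sides)
            (+-mono-≤ (no-3-chain⇒count≤2 right-no-chain) (no-3-chain⇒count≤2 left-no-chain))
    where
    N² right left : Fin n → Bool
    N² u    = S u ∧ sqAdj G s u
    right u = N² u ∧ does (s ≺? u)
    left u  = N² u ∧ does (u ≺? s)

    N²⇒S : ∀ {u} → T (N² u) → T (S u)
    N²⇒S {u} = proj₁ ∘ T-∧⁻ (S u)

    N²⇒walk : ∀ {u} → T (N² u) → ¬ s ≡ u × (E s u ⊎ ∃ λ x → E s x × E x u)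
    N²⇒walk {u} = sqAdj⇒walk ∘ proj₂ ∘ T-∧⁻ (S u)

    at-most-one-between : ∀ {u w w′} → T (N² u) → T (S w) → T (S w′) →
      Between s w u → Between s w′ u → w ≡ w′
    at-most-one-between nu sw sw′ s-w-u s-w′-u with N²⇒walk nu
    ... | _ , inj₁ su            = ⊥-elim (clear₁ su _ sw s-w-u)
    ... | _ , inj₂ (x , sx , xu) =
      trans (Clear-join (clear₁ sx) (clear₂ sx xu) sw s-w-u)
            (sym (Clear-join (clear₁ sx) (clear₂ sx xu) sw′ s-w′-u))

    sides : ∀ u → T (N² u) → T (right u) ⊎ T (left u)
    sides u nu with ≺-cmp s u
    ... | tri< s≺u _ _ = inj₁ (from T-∧ (nu , ⇒does (s ≺? u) s≺u))
    ... | tri≈ _ s≡u _ = ⊥-elim (proj₁ (N²⇒walk nu) s≡u)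
    ... | tri> _ _ u≺s = inj₂ (from T-∧ (nu , ⇒does (u ≺? s) u≺s))

    right-no-chain : ∀ a b c → T (right a) → T (right b) → T (right c) → a ≺ b → b ≺ c → ⊥
    right-no-chain a b c ra rb rc a≺b b≺c with T-∧⁻ (N² a) ra | T-∧⁻ (N² b) rb | T-∧⁻ (N² c) rc
    ... | na , s≺a | nb , s≺b | nc , _ =
      ≺-irrefl (at-most-one-between nc (N²⇒S na) (N²⇒S nb)
                  (inj₁ (does⇒ (s ≺? a) s≺a , ≺-trans a≺b b≺c)) (inj₁ (does⇒ (s ≺? b) s≺b , b≺c))) a≺b

    left-no-chain : ∀ a b c → T (left a) → T (left b) → T (left c) → a ≺ b → b ≺ c → ⊥
    left-no-chain a b c la lb lc a≺b b≺c with T-∧⁻ (N² a) la | T-∧⁻ (N² b) lb | T-∧⁻ (N² c) lc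
    ... | na , _ | nb , b≺s | nc , c≺s =
      ≺-irrefl (at-most-one-between na (N²⇒S nb) (N²⇒S nc)
                  (inj₂ (a≺b , does⇒ (b ≺? s) b≺s)) (inj₂ (≺-trans a≺b b≺c , does⇒ (c ≺? s) c≺s))) b≺c

  count-nbrs-except₂ : ∀ {x a b} → E x a → E x b → ¬ a ≡ b →
    count (λ u → (adj G x u ∧ not (does (u ≟ a))) ∧ not (does (u ≟ b))) ≤ degree G x ∸ 2
  count-nbrs-except₂ {x} {a} {b} xa xb a≢b = ∸-monoˡ-≤ 2
    (≤-trans (s≤s (count-remove (λ u → adj G x u ∧ not (does (u ≟ a)))
                                (from T-∧ (xb , ⇒¬does (b ≟ a) (a≢b ∘ sym)))))
             (count-remove (adj G x) xa))

  NonCrossing : Set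
  NonCrossing = ∀ a b c d → E a b → E c d → ¬ (a ≺ c × c ≺ b × b ≺ d)

  module Window (noncrossing : NonCrossing) (S : Fin n → Bool) {p q : Fin n} (pq : E p q) (p≺q : p ≺ q)
                (narrowest : ∀ {a b} → E a b → Occupied S a b → span p q ≤ span a b) where

    Inner Within : Fin n → Set
    Inner y  = p ≺ y × y ≺ q
    Within y = ¬ y ≺ p × ¬ q ≺ y

    inner⇒within : ∀ {y} → Inner y → Within y
    inner⇒within (p≺y , y≺q) = ≺-asym p≺y , ≺-asym y≺q

    within-p : Within p
    within-p = ≺-irrefl refl , ≺-asym p≺q

    within-q : Within q
    within-q = ≺-asym p≺q , ≺-irrefl refl

    within-cases : ∀ {y} → Within y → y ≡ p ⊎ y ≡ q ⊎ Inner y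
    within-cases {y} (y⊀p , q⊀y) with ≺-cmp p y | ≺-cmp y q
    ... | tri≈ _ p≡y _ | _            = inj₁ (sym p≡y)
    ... | _            | tri≈ _ y≡q _ = inj₂ (inj₁ y≡q)
    ... | tri< p≺y _ _ | tri< y≺q _ _ = inj₂ (inj₂ (p≺y , y≺q))
    ... | tri> _ _ y≺p | _            = ⊥-elim (y⊀p y≺p)
    ... | _            | tri> _ _ q≺y = ⊥-elim (q⊀y q≺y)

    inner-nbr-within : ∀ {x y} → Inner x → E x y → Within y
    inner-nbr-within {x} {y} (p≺x , x≺q) xy =
      (λ y≺p → noncrossing y x p q (E-sym xy) pq (y≺p , p≺x , x≺q)) ,
      (λ q≺y → noncrossing p q x y pq xy (p≺x , x≺q , q≺y))

    occupied-within⇒window : ∀ {a b} → E a b → Occupied S a b → Within a → Within b → a ≡ p × b ≡ q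
    occupied-within⇒window ab occ@(_ , _ , a≺w , w≺b) (a⊀p , _) (_ , q⊀b)
      with nested-span (≮⇒≥ a⊀p) (<⇒≤ (≺-trans a≺w w≺b)) (≮⇒≥ q⊀b) (narrowest ab occ)
    ... | a≡p , b≡q = rank-injective a≡p , rank-injective b≡q

    inner-edge-clear : ∀ {x y} → Inner x → E x y → Clear S x y
    inner-edge-clear ix@(p≺x , x≺q) xy w sw (inj₁ (x≺w , w≺y)) =
      ≺-irrefl (sym (proj₁ (occupied-within⇒window xy (w , sw , x≺w , w≺y)
                                                    (inner⇒within ix) (inner-nbr-within ix xy)))) p≺x
    inner-edge-clear ix@(p≺x , x≺q) xy w sw (inj₂ (y≺w , w≺x)) =
      ≺-irrefl (proj₂ (occupied-within⇒window (E-sym xy) (w , sw , y≺w , w≺x)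
                                               (inner-nbr-within ix xy) (inner⇒within ix))) x≺q

    middle-nbr-inner : ∀ {v x} → Inner v → Occupied S p v → Occupied S v q → E v x → Inner x
    middle-nbr-inner {v} iv@(p≺v , v≺q) left right vx with within-cases (inner-nbr-within iv vx)
    ... | inj₁ refl        =
      ⊥-elim (≺-irrefl (proj₂ (occupied-within⇒window (E-sym vx) left within-p (inner⇒within iv))) v≺q)
    ... | inj₂ (inj₁ refl) =
      ⊥-elim (≺-irrefl (sym (proj₁ (occupied-within⇒window vx right (inner⇒within iv) within-q))) p≺v)
    ... | inj₂ (inj₂ ix)   = ix

    module NoMiddle (k : ℕ) (3≤k : 3 ≤ k) (deg : ∀ v → degree G v ≤ k)
                    {s₁ : Fin n} (ss₁ : T (S s₁)) (is₁ : Inner s₁)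
                  (no-middle : ∀ {v} → T (S v) → Occupied S p v → Occupied S v q → ⊥) where

      inside others : Fin n → Bool
      inside u = S u ∧ (does (p ≺? u) ∧ does (u ≺? q))
      others u = inside u ∧ not (does (u ≟ s₁))

      via : Fin n → Fin n → Fin n → Bool
      via x y u = adj G s₁ x ∧ ((adj G x u ∧ not (does (u ≟ s₁))) ∧ not (does (u ≟ y)))

      ⇒inside : ∀ {u} → T (S u) → Inner u → T (inside u)
      ⇒inside {u} su (p≺u , u≺q) = from T-∧ (su , from T-∧ (⇒does (p ≺? u) p≺u , ⇒does (u ≺? q) u≺q))

      inside⇒ : ∀ {u} → T (inside u) → T (S u) × Inner u
      inside⇒ {u} iu with T-∧⁻ (S u) iu
      ... | su , bounds with T-∧⁻ (does (p ≺? u)) bounds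
      ...   | p≺u , u≺q = su , does⇒ (p ≺? u) p≺u , does⇒ (u ≺? q) u≺q

      count-others≤1 : count others ≤ 1
      count-others≤1 =
        ≤-pred (≤-trans (count-remove inside (⇒inside ss₁ is₁)) (no-3-chain⇒count≤2 middle))
        where
        middle : ∀ a b c → T (inside a) → T (inside b) → T (inside c) → a ≺ b → b ≺ c → ⊥
        middle a b c ia ib ic a≺b b≺c with inside⇒ ia | inside⇒ ib | inside⇒ ic
        ... | sa , p≺a , _ | sb , _ | sc , _ , c≺q =
          no-middle sb (a , sa , p≺a , a≺b) (c , sc , b≺c , c≺q)

      others-empty : E s₁ p → E s₁ q → ∀ u → ¬ T (others u)
      others-empty s₁p s₁q u ou with T-∧⁻ (inside u) ou
      ... | iu , u≢s₁ with inside⇒ iu | ≺-cmp u s₁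
      ...   | su , p≺u , _ | tri< u≺s₁ _ _ = inner-edge-clear is₁ s₁p u su (inj₂ (p≺u , u≺s₁))
      ...   | _ | tri≈ _ u≡s₁ _ = ¬does⇒ (u ≟ s₁) u≢s₁ u≡s₁
      ...   | su , _ , u≺q | tri> _ _ s₁≺u = inner-edge-clear is₁ s₁q u su (inj₁ (s₁≺u , u≺q))

      is : Fin n → Fin n → Bool
      is a u = does (u ≟ a)

      Cover : List (Fin n → Bool)
      Cover = is p ∷ is q ∷ others ∷ via p q ∷ via q p ∷ []

      Covered : Fin n → Set
      Covered u = Any (λ g → T (g u)) Cover

      module _ {u : Fin n} where
        within-covered : T (S u) → Within u → ¬ u ≡ s₁ → Covered u
        within-covered su wu u≢s₁ with within-cases wu
        ... | inj₁ u≡p        = here (⇒does (u ≟ p) u≡p)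
        ... | inj₂ (inj₁ u≡q) = there (here (⇒does (u ≟ q) u≡q))
        ... | inj₂ (inj₂ iu)  = there (there (here (from T-∧ (⇒inside su iu , ⇒¬does (u ≟ s₁) u≢s₁))))

        through-covered : ∀ {x} y → E s₁ x → E x u → ¬ u ≡ s₁ → (u ≡ y → Covered u) →
          (T (via x y u) → Covered u) → Dec (u ≡ y) → Covered u
        through-covered _ _   _  _    at-y _     (yes u≡y) = at-y u≡y
        through-covered y s₁x xu u≢s₁ _    via-x (no u≢y)  =
          via-x (from T-∧ (s₁x , from T-∧ (from T-∧ (xu , ⇒¬does (u ≟ s₁) u≢s₁) , ⇒¬does (u ≟ y) u≢y)))

      N²-covered : ∀ u → T (S u ∧ sqAdj G s₁ u) → Covered u
      N²-covered u nu with T-∧⁻ (S u) nu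
      ... | su , sq with sqAdj⇒walk sq
      ...   | s₁≢u , inj₁ s₁u = within-covered su (inner-nbr-within is₁ s₁u) (s₁≢u ∘ sym)
      ...   | s₁≢u , inj₂ (x , s₁x , xu) with within-cases (inner-nbr-within is₁ s₁x)
      ...     | inj₁ refl        = through-covered q s₁x xu (s₁≢u ∘ sym)
                                     (there ∘ here ∘ ⇒does (u ≟ q)) (there ∘ there ∘ there ∘ here) (u ≟ q)
      ...     | inj₂ (inj₁ refl) = through-covered p s₁x xu (s₁≢u ∘ sym)
                                     (here ∘ ⇒does (u ≟ p)) (there ∘ there ∘ there ∘ there ∘ here) (u ≟ p)
      ...     | inj₂ (inj₂ ix)   = within-covered su (inner-nbr-within ix xu) (s₁≢u ∘ sym)

      via-absent : ∀ {x y} → ¬ E s₁ x → count (via x y) ≡ 0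
      via-absent {x} {y} ¬s₁x = count-none {f = via x y} λ u v → ¬s₁x (proj₁ (T-∧⁻ (adj G s₁ x) v))

      via≤ : ∀ {x y} → E x y → ¬ s₁ ≡ y → count (via x y) ≤ k ∸ 2
      via≤ {x} {y} xy s₁≢y with T? (adj G s₁ x)
      ... | yes s₁x = ≤-trans (count-mono {f = via x y} λ u v → proj₂ (T-∧⁻ (adj G s₁ x) v))
                        (≤-trans (count-nbrs-except₂ (E-sym s₁x) xy s₁≢y) (∸-monoˡ-≤ 2 (deg x)))
      ... | no ¬s₁x = ≤-trans (≤-reflexive (via-absent ¬s₁x)) z≤n

      some-part-empty : count others ≡ 0 ⊎ count (via p q) ≡ 0 ⊎ count (via q p) ≡ 0
      some-part-empty with T? (adj G s₁ p) | T? (adj G s₁ q)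
      ... | yes s₁p | yes s₁q = inj₁ (count-none (others-empty s₁p s₁q))
      ... | no ¬s₁p | _       = inj₂ (inj₁ (via-absent ¬s₁p))
      ... | yes _   | no ¬s₁q = inj₂ (inj₂ (via-absent ¬s₁q))

      sqDegree≤2k∸2 : count (λ u → S u ∧ sqAdj G s₁ u) ≤ 2 * k ∸ 2
      sqDegree≤2k∸2 =
        ≤-trans (count-cover Cover N²-covered)
          (≤-trans (+-mono-≤ (count-≟≤1 p) (+-mono-≤ (count-≟≤1 q)
                     (o+[v+w]≤m+m 1≤k∸2 count-others≤1 (via≤ pq s₁≢q) (via≤ (E-sym pq) s₁≢p)
                                  some-part-empty)))
                   (≤-reflexive (2+[k∸2]+[k∸2]≡2*k∸2 (<⇒≤ 3≤k))))
        where
        1≤k∸2 : 1 ≤ k ∸ 2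
        1≤k∸2 = ∸-monoˡ-≤ 2 3≤k
        s₁≢q : ¬ s₁ ≡ q
        s₁≢q s₁≡q = ≺-irrefl s₁≡q (proj₂ is₁)
        s₁≢p : ¬ s₁ ≡ p
        s₁≢p s₁≡p = ≺-irrefl (sym s₁≡p) (proj₁ is₁)

    low-sqDegree-vertex : ∀ k → 3 ≤ k → (∀ v → degree G v ≤ k) → ∀ {s₁} → T (S s₁) → Inner s₁ →
      ∃ λ v → T (S v) × count (λ u → S u ∧ sqAdj G v u) ≤ 2 * k ∸ 2
    low-sqDegree-vertex k 3≤k deg ss₁ is₁
      with Fin.any? (λ v → T? (S v) ×-dec Occupied? S p v ×-dec Occupied? S v q)
    ... | yes (v , sv , left@(_ , _ , p≺w , w≺v) , right@(_ , _ , v≺w′ , w′≺q)) =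
      v , sv ,
      ≤-trans (sqDegree≤4 S v (inner-edge-clear iv) (inner-edge-clear ∘ middle-nbr-inner iv left right))
              (4≤2*k∸2 3≤k)
      where
      iv : Inner v
      iv = ≺-trans p≺w w≺v , ≺-trans v≺w′ w′≺q
    ... | no ¬middle =
      _ , ss₁ , NoMiddle.sqDegree≤2k∸2 k 3≤k deg ss₁ is₁ λ sv left right → ¬middle (_ , sv , left , right)

  OccupiedEdge : (Fin n → Bool) → Fin n × Fin n → Set
  OccupiedEdge S (a , b) = E a b × Occupied S a b

  OccupiedEdge? : ∀ S e → Dec (OccupiedEdge S e)
  OccupiedEdge? S (a , b) = T? (adj G a b) ×-dec Occupied? S a b

  low-sqDegree : NonCrossing → ∀ k → 3 ≤ k → (∀ v → degree G v ≤ k) → ∀ S → ∃ (T ∘ S) →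
    ∃ λ v → T (S v) × count (λ u → S u ∧ sqAdj G v u) ≤ 2 * k ∸ 2
  low-sqDegree noncrossing k 3≤k deg S (s₀ , ss₀)
    with Fin.any? (λ a → Fin.any? λ b → OccupiedEdge? S (a , b))
  ... | no none = s₀ , ss₀ , ≤-trans (sqDegree≤4 S s₀ all-clear (λ _ → all-clear)) (4≤2*k∸2 3≤k)
    where
    all-clear : ∀ {a b} → E a b → Clear S a b
    all-clear {a} {b} ab w sw (inj₁ (a≺w , w≺b)) = none (a , b , ab , w , sw , a≺w , w≺b)
    all-clear {a} {b} ab w sw (inj₂ (b≺w , w≺a)) = none (b , a , E-sym ab , w , sw , b≺w , w≺a)
  ... | yes (a , b , edge)
    with ∃-argmin (OccupiedEdge? S) (λ (a , b) → span a b) (cartesianProduct (allFin n) (allFin n))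
                  (λ (a , b) → ∈-cartesianProduct⁺ (∈-allFin a) (∈-allFin b)) {a , b} edge
  ...   | (p , q) , (pq , s₁ , ss₁ , p≺s₁ , s₁≺q) , narrowest =
    Window.low-sqDegree-vertex noncrossing S pq (≺-trans p≺s₁ s₁≺q)
      (λ ab occ → narrowest (_ , _) (ab , occ)) k 3≤k deg ss₁ (p≺s₁ , s₁≺q)

outerplanar⇒sqInd≤2k∸2 : ∀ {n} (G : SimpleGraph n) (k : ℕ) → 3 ≤ k → (∀ v → degree G v ≤ k) →
  Outerplanar G → IndSqAtMost G (2 * k ∸ 2)
outerplanar⇒sqInd≤2k∸2 G k 3≤k deg (pos , pos-injective , noncrossing) =
  Drawing.low-sqDegree G pos pos-injective noncrossing k 3≤k deg

lemma3p9 : ∀ {n} (G : SimpleGraph n) (k : ℕ) → Outerplanar G → MaxDegree G k →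
    (k ≡ 3 ⊎ k ≡ 4) → IndSqAtMost G (2 * k ∸ 2)
lemma3p9 G k outerplanar (deg , _) k≡3∨4 = outerplanar⇒sqInd≤2k∸2 G k (3≤k k≡3∨4) deg outerplanar
  where
  3≤k : k ≡ 3 ⊎ k ≡ 4 → 3 ≤ k
  3≤k (inj₁ refl) = ≤-refl
  3≤k (inj₂ refl) = s≤s (s≤s (s≤s z≤n))
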